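{- Let $k,d\in\mathbb N$. If two pointed $\Sigma$-labelled two-sorted graphs $(\mathcal G,i)$ and $(\mathcal H,j)$ satisfy the same $\mathrm{GPTL}^{ - }_{\geq}$-type of depth $d$ and width $k$, then there is no $\Sigma$-formula $\varphi$ of $\mathrm{GPTL}^{ - }_{\geq}$ of modal depth $\le d$ and width $\le k$ such that $\mathcal G,i\models\varphi$ and $\mathcal H,j\not\models\varphi$.
   Context: Two-sorted graphs: $\Sigma$ a finite token set, $\mathrm{BOS}\notin\Sigma$; $\mathcal{G}=(V,E,\lambda)$, $V=[n]$, $E=\{(i,i+1)\}$, $\lambda:V\to\Sigma\cup\{\mathrm{BOS}\}$ with exactly one vertex $w$ labelled $\mathrm{BOS}$; prefix = vertices $1,\dots,w-1$; suffix = vertices $w,\dots,n$. A pointed graph is $(\mathcal G,i)$ with $i\in V$. Logic $\mathrm{GPTL}^{ - }_{\geq}$: $\varphi::=\bot\mid p\mid\neg\varphi\mid(\varphi\wedge\varphi)\mid\langle G\rangle^{\text{pre}}_{\ge k}\varphi\mid\langle P\rangle^{\text{suf}}_{\ge k}\varphi$ ($p\in\Sigma$, $k\in\mathbb N$). At $(\mathcal G,w')$: $\bot$ never holds; $p$ holds iff $\lambda(w')=p$; Boolean connectives as usual; $\langle G\rangle^{\text{pre}}_{\ge k}\varphi$ holds iff at least $k$ prefix vertices satisfy $\varphi$; $\langle P\rangle^{\text{suf}}_{\ge k}\varphi$ holds iff at least $k$ suffix vertices $u<w'$ satisfy $\varphi$. Abbreviations: $\langle G\rangle^{\text{pre}}_{=k}\varphi:=\langle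 G\rangle^{\text{pre}}_{\ge k}\varphi\wedge\neg\langle G\rangle^{\text{pre}}_{\ge k+1}\varphi$, and likewise $\langle P\rangle^{\text{suf}}_{=k}\varphi$. Modal depth $\mathsf{md}$: $0$ for $\bot,p$; unchanged by $\neg$; max for $\wedge$; $+1$ for each modality. Width: $0$ for $\bot,p$; unchanged by $\neg$; max for $\wedge$; $\mathsf{width}(\langle G\rangle^{\text{pre}}_{\ge k}\psi)=\mathsf{width}(\langle P\rangle^{\text{suf}}_{\ge k}\psi)=\max\{\mathsf{width}(\psi),k\}$. Types: $\tau^{(\mathcal G,i)}_{k,0}:=\bigwedge_{\lambda(i)=p}p\wedge\bigwedge_{\lambda(i)\ne p}\neg p$. With $T_{k,d}$ the (finite) set of all types $\tau^{(\mathcal G,i)}_{k,d}$ over all pointed graphs, $\tau^{(\mathcal G,i)}_{k,d+1}$ is the conjunction of $\tau^{(\mathcal G,i)}_{k,0}$ with: all $\langle G\rangle^{\text{pre}}_{=\ell}\tau$ ($0\le\ell\le k-1$, $\tau\in T_{k,d}$) true at $(\mathcal G,i)$; all $\langle G\rangle^{\text{pre}}_{\ge k}\tau$ ($\tau\in T_{k,d}$) true at $(\mathcal G,i)$; all $\langle P\rangle^{\text{suf}}_{=\ell}\tau$ ($0\le\ell\le k-1$) true at $(\mathcal G,i)$; all $\langle P\rangle^{\text{suf}}_{\ge k}\tau$ true at $(\mathcal G,i)$. This is the $\mathrm{GPTL}^{ - }_{\geq}$-type of depth $d+1$ and width $k$ of $(\mathcal G,i)$. -}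

module Defs where

open import Data.Nat using (ℕ; zero; suc; _<ᵇ_; _≤ᵇ_; _⊔_; _⊓_)
open import Data.Fin using (Fin; toℕ)
open import Data.Fin.Properties using () renaming (_≟_ to _≟ᶠ_)
open import Data.Maybe using (Maybe; just; nothing)
open import Data.Bool using (Bool; true; false; not; _∧_; if_then_else_)
open import Data.List using (List; []; _∷_; map; filter; length; concatMap; upTo; allFin; zip)
open import Data.Product using (_×_; _,_)
open import Relation.Binary.PropositionalEquality using (_≡_)
open import Relation.Nullary using (does)

-- Token set Σ is Fin s.  A label is  just p  (p ∈ Σ) or  nothing  (= BOS).

Label : ℕ → Set
Label s = Maybe (Fin s)

-- Two-sorted graph: vertices Fin n (0-based version of [n]); edges are
-- implicitly (v, v+1); exactly one vertex (bos) is labelled BOS.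
record Graph (s : ℕ) : Set where
  field
    n          : ℕ
    lab        : Fin n → Label s
    bos        : Fin n
    bos-lab    : lab bos ≡ nothing
    bos-unique : ∀ v → lab v ≡ nothing → v ≡ bos
open Graph public

Vertex : ∀ {s} → Graph s → Set
Vertex G = Fin (n G)

isPrefix : ∀ {s} (G : Graph s) → Vertex G → Bool
isPrefix G v = toℕ v <ᵇ toℕ (bos G)

isSuffix : ∀ {s} (G : Graph s) → Vertex G → Bool
isSuffix G v = toℕ (bos G) ≤ᵇ toℕ v

data Formula (s : ℕ) : Set where
  ⊥f   : Formula s
  var  : Fin s → Formula s
  ¬f_  : Formula s → Formula s
  _∧f_ : Formula s → Formula s → Formula s
  ⟨G⟩pre≥ : ℕ → Formula s → Formula s
  ⟨P⟩suf≥ : ℕ → Formula s → Formula s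

md : ∀ {s} → Formula s → ℕ
md ⊥f = 0
md (var _) = 0
md (¬f φ) = md φ
md (φ ∧f ψ) = md φ ⊔ md ψ
md (⟨G⟩pre≥ _ φ) = suc (md φ)
md (⟨P⟩suf≥ _ φ) = suc (md φ)

width : ∀ {s} → Formula s → ℕ
width ⊥f = 0
width (var _) = 0
width (¬f φ) = width φ
width (φ ∧f ψ) = width φ ⊔ width ψ
width (⟨G⟩pre≥ k φ) = width φ ⊔ k
width (⟨P⟩suf≥ k φ) = width φ ⊔ k

⊤f : ∀ {s} → Formula s
⊤f = ¬f ⊥f

⟨G⟩pre= : ∀ {s} → ℕ → Formula s → Formula s
⟨G⟩pre= k φ = ⟨G⟩pre≥ k φ ∧f (¬f ⟨G⟩pre≥ (suc k) φ)

⟨P⟩suf= : ∀ {s} → ℕ → Formula s → Formula s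
⟨P⟩suf= k φ = ⟨P⟩suf≥ k φ ∧f (¬f ⟨P⟩suf≥ (suc k) φ)

countB : ∀ {m} → (Fin m → Bool) → ℕ
countB {m} f = length (filter (λ v → Data.Bool._≟_ (f v) true) (allFin m))

eval : ∀ {s} (G : Graph s) → Formula s → Vertex G → Bool
eval G ⊥f v = false
eval G (var p) v with lab G v
... | just q  = does (p ≟ᶠ q)
... | nothing = false
eval G (¬f φ) v = not (eval G φ v)
eval G (φ ∧f ψ) v = eval G φ v ∧ eval G ψ v
eval G (⟨G⟩pre≥ k φ) v =
  k ≤ᵇ countB (λ u → isPrefix G u ∧ eval G φ u)
eval G (⟨P⟩suf≥ k φ) v =
  k ≤ᵇ countB (λ u → isSuffix G u ∧ (toℕ u <ᵇ toℕ v) ∧ eval G φ u)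

_,_⊨_ : ∀ {s} (G : Graph s) → Vertex G → Formula s → Set
G , i ⊨ φ = eval G φ i ≡ true

bigAnd : ∀ {s} → List (Formula s) → Formula s
bigAnd [] = ⊤f
bigAnd (φ ∷ []) = φ
bigAnd (φ ∷ φs@(_ ∷ _)) = φ ∧f bigAnd φs

litType : ∀ {s} → Label s → Formula s
litType {s} a =
  bigAnd (map var (filter (λ p → Data.Maybe.Properties.≡-dec _≟ᶠ_ a (just p)) (allFin s)))
  ∧f bigAnd (map (λ p → ¬f var p)
                 (filter (λ p → Relation.Nullary.¬? (Data.Maybe.Properties.≡-dec _≟ᶠ_ a (just p))) (allFin s)))
  where import Data.Maybe.Properties
        import Relation.Nullary

-- Given k, τ and the count c capped at k (c = min(count, k)):
-- the unique true formula among ⟨·⟩_{=ℓ} τ (ℓ < k) and ⟨·⟩_{≥k} τ.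
preFact : ∀ {s} → ℕ → Formula s × ℕ → Formula s
preFact k (τ , c) = if c <ᵇ k then ⟨G⟩pre= c τ else ⟨G⟩pre≥ k τ

sufFact : ∀ {s} → ℕ → Formula s × ℕ → Formula s
sufFact k (τ , c) = if c <ᵇ k then ⟨P⟩suf= c τ else ⟨P⟩suf≥ k τ

mkType : ∀ {s} → ℕ → Label s → List (Formula s × ℕ) → List (Formula s × ℕ) → Formula s
mkType k a pre suf =
  litType a ∧f (bigAnd (map (preFact k) pre) ∧f bigAnd (map (sufFact k) suf))

allLabels : ∀ s → List (Label s)
allLabels s = nothing ∷ map just (allFin s)

seqs : ℕ → ℕ → List (List ℕ)
seqs k zero = [] ∷ []
seqs k (suc m) = concatMap (λ c → map (c ∷_) (seqs k m)) (upTo (suc k))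

-- A finite list of candidate types containing every type of depth d and width k
-- (unrealised candidates are satisfied by no vertex).
candidates : ∀ {s} → ℕ → ℕ → List (Formula s)
candidates {s} k zero = map litType (allLabels s)
candidates {s} k (suc d) =
  concatMap (λ a →
    concatMap (λ cs →
      map (λ ds → mkType k a (zip T cs) (zip T ds)) (seqs k (length T)))
      (seqs k (length T)))
    (allLabels s)
  where T = candidates {s} k d

typeOf : ∀ {s} (k d : ℕ) (G : Graph s) → Vertex G → Formula s
typeOf k zero G i = litType (lab G i)
typeOf {s} k (suc d) G i =
  mkType k (lab G i)
    (map (λ τ → τ , (countB (λ u → isPrefix G u ∧ eval G τ u) ⊓ k)) T)
    (map (λ τ → τ , (countB (λ u → isSuffix G u ∧ (toℕ u <ᵇ toℕ i) ∧ eval G τ u) ⊓ k)) T)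
  where T = candidates {s} k d

{-# OPTIONS --safe #-}
-- Every vertex satisfies its own type, and satisfying the type of a vertex w forces having the same
-- type as w; so the types of depth d realised in two graphs partition their vertices into classes.
-- By induction on formulas, a formula of depth ≤ d and width ≤ k is constant on each class. A
-- counting modality applied to such a ψ therefore counts a sum, over the classes on which ψ holds,
-- of the numbers of prefix (or earlier suffix) vertices in the class. The type of depth d+1 records
-- each of these numbers capped at k; a sum capped at k only depends on its capped summands, and a
-- threshold m ≤ k only sees the count capped at k.
module Submission where

open import Defs
open import Data.Nat using (ℕ; _≤_)
open import Data.Product using (Σ-syntax; _×_)
open import Relation.Nullary using (¬_)
open import Relation.Binary.PropositionalEquality using (_≡_)

open import Data.Bool using (Bool; true; false; not; _∧_; if_then_else_; _≟_)
open import Data.Bool.Properties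
  using (∧-conicalˡ; ∧-conicalʳ; ∧-assoc; ∧-identityʳ; ∧-zeroʳ; ¬-not; not-¬; if-float)
open import Data.Fin using (Fin; toℕ)
open import Data.Fin.Properties using (any?) renaming (_≟_ to _≟ᶠ_)
open import Data.List using (List; []; _∷_; _++_; map; filter; length; allFin; zip; concatMap)
open import Data.List.Properties using (map-cong-local; length-map)
open import Data.List.Membership.Propositional using (_∈_; lose)
open import Data.List.Membership.Propositional.Properties
  using (∈-map⁺; ∈-map⁻; ∈-++⁺ˡ; ∈-++⁺ʳ; ∈-allFin; ∈-upTo⁺; ∈-concatMap⁺; ∈-filter⁺)
open import Data.List.Relation.Unary.All using (All; []; _∷_; lookup; tabulate; universal)
import Data.List.Relation.Unary.All as All
import Data.List.Relation.Unary.All.Properties as All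
open import Data.List.Relation.Unary.Any using (Any; here; there)
open import Data.Maybe using (just; nothing)
open import Data.Maybe.Properties using (≡-dec)
open import Data.Nat using (zero; suc; _+_; _⊓_; _<_; _≤ᵇ_; _<ᵇ_; s≤s; _≤?_; _<?_)
open import Data.Nat.Properties
  using (≤-refl; ≤-total; ≤-trans; ≤-antisym; <⇒≤; ≮⇒≥; n≮n; m≤m+n; m⊓n≤m; m⊓n≤n; ⊓-glb;
         m≤n⇒m⊓n≡m; m≥n⇒m⊓n≡n; +-suc; +-comm; m⊔n≤o⇒m≤o; m⊔n≤o⇒n≤o; <ᵇ-reflects-<; ≤ᵇ-reflects-≤)
open import Data.Product using (Σ; _,_; proj₁; proj₂; uncurry)
open import Data.Sum using (_⊎_; inj₁; inj₂)
open import Function using (_∘_)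
open import Function.Bundles using (mk⇔)
open import Relation.Binary.PropositionalEquality
  using (refl; sym; trans; cong; cong₂; subst; module ≡-Reasoning)
open import Relation.Nullary using (yes; no; ¬?; contradiction)
open import Relation.Nullary.Decidable using (dec-true; dec-false; does-⇔)
open import Relation.Nullary.Reflects using (ofʸ; ofⁿ)

open ≡-Reasoning

-- countB f unfolds to countIn f (allFin _), so the lemmas on countIn apply to countB directly.
countIn : {A : Set} → (A → Bool) → List A → ℕ
countIn f xs = length (filter (λ v → f v ≟ true) xs)

module _ {A : Set} where

  countIn-cong : {f g : A → Bool} → (∀ u → f u ≡ g u) → ∀ xs → countIn f xs ≡ countIn g xs
  countIn-cong f≗g [] = refl
  countIn-cong {f} {g} f≗g (x ∷ xs) with f x | g x | f≗g x
  ... | true  | .true  | refl = cong suc (countIn-cong f≗g xs)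
  ... | false | .false | refl = countIn-cong f≗g xs

  countIn-false : {f : A → Bool} → (∀ u → f u ≡ false) → ∀ xs → countIn f xs ≡ 0
  countIn-false f≗false [] = refl
  countIn-false f≗false (x ∷ xs) rewrite f≗false x = countIn-false f≗false xs

  countIn-split : ∀ (f g : A → Bool) xs →
    countIn f xs ≡ countIn (λ u → f u ∧ g u) xs + countIn (λ u → f u ∧ not (g u)) xs
  countIn-split f g [] = refl
  countIn-split f g (x ∷ xs) with f x | g x
  ... | true  | true  = cong suc (countIn-split f g xs)
  ... | true  | false = trans (cong suc (countIn-split f g xs)) (sym (+-suc _ _))
  ... | false | _     = countIn-split f g xs

∧-∧-restrict : ∀ x {y} z {b} → (z ≡ true → y ≡ b) → (x ∧ y) ∧ z ≡ (x ∧ z) ∧ b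
∧-∧-restrict false _     _   = refl
∧-∧-restrict true  false _   = ∧-zeroʳ _
∧-∧-restrict true  true  y≡b = trans (∧-identityʳ _) (y≡b refl)

[m+n]⊓o≡[m⊓o+n]⊓o : ∀ m n o → (m + n) ⊓ o ≡ (m ⊓ o + n) ⊓ o
[m+n]⊓o≡[m⊓o+n]⊓o m n o with ≤-total m o
... | inj₁ m≤o rewrite m≤n⇒m⊓n≡m m≤o = refl
... | inj₂ o≤m rewrite m≥n⇒m⊓n≡n o≤m =
  trans (m≥n⇒m⊓n≡n (≤-trans o≤m (m≤m+n m n))) (sym (m≥n⇒m⊓n≡n (m≤m+n o n)))

[m+n]⊓o≡[m⊓o+n⊓o]⊓o : ∀ m n o → (m + n) ⊓ o ≡ (m ⊓ o + n ⊓ o) ⊓ o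
[m+n]⊓o≡[m⊓o+n⊓o]⊓o m n o = begin
  (m + n) ⊓ o          ≡⟨ [m+n]⊓o≡[m⊓o+n]⊓o m n o ⟩
  (m ⊓ o + n) ⊓ o      ≡⟨ cong (_⊓ o) (+-comm (m ⊓ o) n) ⟩
  (n + m ⊓ o) ⊓ o      ≡⟨ [m+n]⊓o≡[m⊓o+n]⊓o n (m ⊓ o) o ⟩
  (n ⊓ o + m ⊓ o) ⊓ o  ≡⟨ cong (_⊓ o) (+-comm (n ⊓ o) (m ⊓ o)) ⟩
  (m ⊓ o + n ⊓ o) ⊓ o  ∎

+-cong-⊓ : ∀ {m m′ n n′} o → m ⊓ o ≡ m′ ⊓ o → n ⊓ o ≡ n′ ⊓ o → (m + n) ⊓ o ≡ (m′ + n′) ⊓ o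
+-cong-⊓ {m} {m′} {n} {n′} o m≈m′ n≈n′ = begin
  (m + n) ⊓ o            ≡⟨ [m+n]⊓o≡[m⊓o+n⊓o]⊓o m n o ⟩
  (m ⊓ o + n ⊓ o) ⊓ o    ≡⟨ cong₂ (λ a b → (a + b) ⊓ o) m≈m′ n≈n′ ⟩
  (m′ ⊓ o + n′ ⊓ o) ⊓ o  ≡⟨ [m+n]⊓o≡[m⊓o+n⊓o]⊓o m′ n′ o ⟨
  (m′ + n′) ⊓ o          ∎

≤ᵇ-cong-⊓ : ∀ {m n n′ o} → m ≤ o → n ⊓ o ≡ n′ ⊓ o → (m ≤ᵇ n) ≡ (m ≤ᵇ n′)
≤ᵇ-cong-⊓ {m} {n} {n′} {o} m≤o n≈n′ = begin
  m ≤ᵇ n       ≡⟨ ≤ᵇ≡≤ᵇ⊓ n ⟩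
  m ≤ᵇ n ⊓ o   ≡⟨ cong (m ≤ᵇ_) n≈n′ ⟩
  m ≤ᵇ n′ ⊓ o  ≡⟨ ≤ᵇ≡≤ᵇ⊓ n′ ⟨
  m ≤ᵇ n′      ∎
  where
  ≤ᵇ≡≤ᵇ⊓ : ∀ x → (m ≤ᵇ x) ≡ (m ≤ᵇ x ⊓ o)
  ≤ᵇ≡≤ᵇ⊓ x = does-⇔ (mk⇔ (λ m≤x → ⊓-glb m≤x m≤o) (λ m≤x⊓o → ≤-trans m≤x⊓o (m⊓n≤m x o)))
                     (m ≤? x) (m ≤? x ⊓ o)

countB-∧-cong-⊓ : ∀ {m₁ m₂} {f₁ : Fin m₁ → Bool} {f₂ : Fin m₂ → Bool} k b →
  countB f₁ ⊓ k ≡ countB f₂ ⊓ k → countB (λ u → f₁ u ∧ b) ⊓ k ≡ countB (λ u → f₂ u ∧ b) ⊓ k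
countB-∧-cong-⊓ {m₁} {m₂} {f₁} {f₂} k true f₁≈f₂ = begin
  countB (λ u → f₁ u ∧ true) ⊓ k  ≡⟨ cong (_⊓ k) (countIn-cong (λ u → ∧-identityʳ (f₁ u)) (allFin m₁)) ⟩
  countB f₁ ⊓ k                   ≡⟨ f₁≈f₂ ⟩
  countB f₂ ⊓ k                   ≡⟨ cong (_⊓ k) (countIn-cong (λ u → ∧-identityʳ (f₂ u)) (allFin m₂)) ⟨
  countB (λ u → f₂ u ∧ true) ⊓ k  ∎
countB-∧-cong-⊓ {m₁} {m₂} {f₁} {f₂} k false _ =
  cong (_⊓ k) (trans (countIn-false (λ u → ∧-zeroʳ (f₁ u)) (allFin m₁))
                     (sym (countIn-false (λ u → ∧-zeroʳ (f₂ u)) (allFin m₂))))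

≤⇒≤ᵇ≡true : ∀ {m n} → m ≤ n → (m ≤ᵇ n) ≡ true
≤⇒≤ᵇ≡true {m} {n} = dec-true (m ≤? n)

<⇒<ᵇ≡true : ∀ {m n} → m < n → (m <ᵇ n) ≡ true
<⇒<ᵇ≡true {m} {n} = dec-true (m <? n)

≮⇒<ᵇ≡false : ∀ {m n} → ¬ m < n → (m <ᵇ n) ≡ false
≮⇒<ᵇ≡false {m} {n} = dec-false (m <? n)

isCappedCount : ℕ → ℕ → ℕ → Bool
isCappedCount k c N = if c <ᵇ k then (c ≤ᵇ N) ∧ not (c <ᵇ N) else k ≤ᵇ N

isCappedCount-self : ∀ k N → isCappedCount k (N ⊓ k) N ≡ true
isCappedCount-self k N with N <? k
... | yes N<k rewrite m≤n⇒m⊓n≡m (<⇒≤ N<k) | <⇒<ᵇ≡true N<k | ≤⇒≤ᵇ≡true (≤-refl {N}) | ≮⇒<ᵇ≡false (n≮n N)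
  = refl
... | no N≮k rewrite m≥n⇒m⊓n≡n (≮⇒≥ N≮k) | ≮⇒<ᵇ≡false (n≮n k) | ≤⇒≤ᵇ≡true (≮⇒≥ N≮k)
  = refl

isCappedCount⇒≡ : ∀ {k c N} → c ≤ k → isCappedCount k c N ≡ true → c ≡ N ⊓ k
isCappedCount⇒≡ {k} {c} {N} c≤k _ with c <ᵇ k | <ᵇ-reflects-< c k
... | false | ofⁿ c≮k with k ≤ᵇ N | ≤ᵇ-reflects-≤ k N
...   | true | ofʸ k≤N = trans (≤-antisym c≤k (≮⇒≥ c≮k)) (sym (m≥n⇒m⊓n≡n k≤N))
isCappedCount⇒≡ c≤k () | false | ofⁿ _ | false | _
isCappedCount⇒≡ {k} {c} {N} c≤k _ | true | ofʸ c<k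
  with c ≤ᵇ N | ≤ᵇ-reflects-≤ c N | c <ᵇ N | <ᵇ-reflects-< c N
... | true | ofʸ c≤N | false | ofⁿ c≮N =
  sym (trans (cong (_⊓ k) (≤-antisym (≮⇒≥ c≮N) c≤N)) (m≤n⇒m⊓n≡m (<⇒≤ c<k)))
isCappedCount⇒≡ c≤k () | true | _ | true  | _ | true | _
isCappedCount⇒≡ c≤k () | true | _ | false | _ | _    | _

module _ {A : Set} {m : ℕ} where

  record Partitions (P : A → Fin m → Bool) (L : List A) (f : Fin m → Bool) : Set where
    field
      covers    : ∀ u → f u ≡ true → Any (λ τ → P τ u ≡ true) L
      exclusive : ∀ {τ τ′ u} → τ ∈ L → τ′ ∈ L → P τ u ≡ true → P τ′ u ≡ true → τ ≡ τ′

  open Partitions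

  Partitions-∷ : ∀ {P τ L f} → Partitions P (τ ∷ L) f → Partitions P L (λ u → f u ∧ not (P τ u))
  Partitions-∷ π .covers u fu∧¬Pτu with covers π u (∧-conicalˡ _ _ fu∧¬Pτu)
  ... | here Pτu  = contradiction (sym (∧-conicalʳ _ _ fu∧¬Pτu)) (not-¬ (sym Pτu))
  ... | there any = any
  Partitions-∷ π .exclusive τ∈ τ′∈ = exclusive π (there τ∈) (there τ′∈)

  Partitions-[]⇒countB≡0 : ∀ {P f} → Partitions P [] f → countB f ≡ 0
  Partitions-[]⇒countB≡0 π =
    countIn-false (λ u → ¬-not (λ fu → contradiction (covers π u fu) λ ())) (allFin m)

  -- Decided by searching the vertices for a common member, so A needs no decidable equality.
  equal-or-disjoint : ∀ {P L f τ τ′} → Partitions P L f → τ ∈ L → τ′ ∈ L →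
    τ ≡ τ′ ⊎ (∀ u → P τ u ∧ P τ′ u ≡ false)
  equal-or-disjoint {P} {τ = τ} {τ′} π τ∈ τ′∈ with any? (λ u → P τ u ∧ P τ′ u ≟ true)
  ... | yes (u , both) = inj₁ (exclusive π τ∈ τ′∈ (∧-conicalˡ _ _ both) (∧-conicalʳ _ _ both))
  ... | no none        = inj₂ (λ u → ¬-not (λ both → none (u , both)))

countB-⊓-partition : ∀ {A : Set} {m₁ m₂} (k : ℕ) {P₁ : A → Fin m₁ → Bool} {P₂ : A → Fin m₂ → Bool}
  L {f₁ f₂} → Partitions P₁ L f₁ → Partitions P₂ L f₂ →
  (∀ {τ} → τ ∈ L → countB (λ u → f₁ u ∧ P₁ τ u) ⊓ k ≡ countB (λ u → f₂ u ∧ P₂ τ u) ⊓ k) →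
  countB f₁ ⊓ k ≡ countB f₂ ⊓ k
countB-⊓-partition k [] π₁ π₂ _ =
  cong (_⊓ k) (trans (Partitions-[]⇒countB≡0 π₁) (sym (Partitions-[]⇒countB≡0 π₂)))
countB-⊓-partition {m₁ = m₁} {m₂} k {P₁} {P₂} (τ ∷ L) {f₁} {f₂} π₁ π₂ classes = begin
  countB f₁ ⊓ k
    ≡⟨ cong (_⊓ k) (countIn-split f₁ (P₁ τ) (allFin m₁)) ⟩
  (countB (λ u → f₁ u ∧ P₁ τ u) + countB (λ u → f₁ u ∧ not (P₁ τ u))) ⊓ k
    ≡⟨ +-cong-⊓ k (classes (here refl))
                  (countB-⊓-partition k L (Partitions-∷ π₁) (Partitions-∷ π₂) remainingClasses) ⟩
  (countB (λ u → f₂ u ∧ P₂ τ u) + countB (λ u → f₂ u ∧ not (P₂ τ u))) ⊓ k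
    ≡⟨ cong (_⊓ k) (countIn-split f₂ (P₂ τ) (allFin m₂)) ⟨
  countB f₂ ⊓ k ∎
  where
  ∧-not-∧-self : ∀ x y → (x ∧ not y) ∧ y ≡ false
  ∧-not-∧-self false y     = refl
  ∧-not-∧-self true  false = refl
  ∧-not-∧-self true  true  = refl

  ∧-not-∧-disjoint : ∀ x {y z} → y ∧ z ≡ false → (x ∧ not y) ∧ z ≡ x ∧ z
  ∧-not-∧-disjoint false         _       = refl
  ∧-not-∧-disjoint true {true}  z≡false = sym z≡false
  ∧-not-∧-disjoint true {false} _       = refl

  removedClass : countB (λ u → (f₁ u ∧ not (P₁ τ u)) ∧ P₁ τ u) ⊓ k
               ≡ countB (λ u → (f₂ u ∧ not (P₂ τ u)) ∧ P₂ τ u) ⊓ k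
  removedClass = cong (_⊓ k) (trans (countIn-false (λ u → ∧-not-∧-self (f₁ u) (P₁ τ u)) (allFin m₁))
                                    (sym (countIn-false (λ u → ∧-not-∧-self (f₂ u) (P₂ τ u)) (allFin m₂))))

  remainingClasses : ∀ {τ′} → τ′ ∈ L →
    countB (λ u → (f₁ u ∧ not (P₁ τ u)) ∧ P₁ τ′ u) ⊓ k ≡ countB (λ u → (f₂ u ∧ not (P₂ τ u)) ∧ P₂ τ′ u) ⊓ k
  remainingClasses {τ′} τ′∈
    with equal-or-disjoint π₁ (here refl) (there τ′∈) | equal-or-disjoint π₂ (here refl) (there τ′∈)
  ... | inj₁ refl      | _              = removedClass
  ... | inj₂ _         | inj₁ refl      = removedClass
  ... | inj₂ disjoint₁ | inj₂ disjoint₂ = begin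
    countB (λ u → (f₁ u ∧ not (P₁ τ u)) ∧ P₁ τ′ u) ⊓ k
      ≡⟨ cong (_⊓ k) (countIn-cong (λ u → ∧-not-∧-disjoint (f₁ u) (disjoint₁ u)) (allFin m₁)) ⟩
    countB (λ u → f₁ u ∧ P₁ τ′ u) ⊓ k
      ≡⟨ classes (there τ′∈) ⟩
    countB (λ u → f₂ u ∧ P₂ τ′ u) ⊓ k
      ≡⟨ cong (_⊓ k) (countIn-cong (λ u → ∧-not-∧-disjoint (f₂ u) (disjoint₂ u)) (allFin m₂)) ⟨
    countB (λ u → (f₂ u ∧ not (P₂ τ u)) ∧ P₂ τ′ u) ⊓ k ∎

∈-seqs : ∀ {k} cs → All (_≤ k) cs → cs ∈ seqs k (length cs)
∈-seqs []       []             = here refl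
∈-seqs {k} (c ∷ cs) (c≤k ∷ cs≤k) =
  ∈-concatMap⁺ (λ c → map (c ∷_) (seqs k (length cs)))
               (lose (∈-upTo⁺ (s≤s c≤k)) (∈-map⁺ (c ∷_) (∈-seqs cs cs≤k)))

cappedCounts∈seqs : ∀ {A : Set} k (f : A → ℕ) xs → map (λ x → f x ⊓ k) xs ∈ seqs k (length xs)
cappedCounts∈seqs k f xs =
  subst (λ l → map (λ x → f x ⊓ k) xs ∈ seqs k l) (length-map (λ x → f x ⊓ k) xs)
        (∈-seqs _ (All.map⁺ (universal (λ x → m⊓n≤n (f x) k) xs)))

zip-map-graph : ∀ {A B : Set} (f : A → B) xs → zip xs (map f xs) ≡ map (λ x → x , f x) xs
zip-map-graph f []       = refl
zip-map-graph f (x ∷ xs) = cong ((x , f x) ∷_) (zip-map-graph f xs)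

module _ {s : ℕ} where

  ⊨-bigAnd⁺ : ∀ {X : Graph s} {v} φs → All (λ φ → X , v ⊨ φ) φs → X , v ⊨ bigAnd φs
  ⊨-bigAnd⁺ []               []       = refl
  ⊨-bigAnd⁺ (φ ∷ [])         (p ∷ []) = p
  ⊨-bigAnd⁺ (φ ∷ φs@(_ ∷ _)) (p ∷ ps) = cong₂ _∧_ p (⊨-bigAnd⁺ φs ps)

  ⊨-bigAnd⁻ : ∀ {X : Graph s} {v} φs → X , v ⊨ bigAnd φs → All (λ φ → X , v ⊨ φ) φs
  ⊨-bigAnd⁻ []               _ = []
  ⊨-bigAnd⁻ (φ ∷ [])         p = p ∷ []
  ⊨-bigAnd⁻ (φ ∷ φs@(_ ∷ _)) p = ∧-conicalˡ _ _ p ∷ ⊨-bigAnd⁻ φs (∧-conicalʳ _ _ p)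

  ⊨-var⁺ : ∀ {X : Graph s} {v p} → lab X v ≡ just p → X , v ⊨ var p
  ⊨-var⁺ {p = p} lab≡ rewrite lab≡ = dec-true (p ≟ᶠ p) refl

  ⊨-var⁻ : ∀ {X : Graph s} {v p} → X , v ⊨ var p → lab X v ≡ just p
  ⊨-var⁻ {X} {v} {p} ⊨p with lab X v
  ... | nothing = contradiction ⊨p λ ()
  ... | just q with p ≟ᶠ q
  ...   | yes refl = refl
  ...   | no _     = contradiction ⊨p λ ()

  eval-var-cong : ∀ {X Y : Graph s} {u w} p → lab X u ≡ lab Y w → eval X (var p) u ≡ eval Y (var p) w
  eval-var-cong {X} {Y} {u} {w} p lab≡ with lab X u | lab Y w | lab≡
  ... | _ | _ | refl = refl

  ⊨-litType-self : ∀ (X : Graph s) v → X , v ⊨ litType (lab X v)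
  ⊨-litType-self X v = cong₂ _∧_
    (⊨-bigAnd⁺ _ (All.map⁺ (All.map (⊨-var⁺ {X} {v}) (All.all-filter _ (allFin s)))))
    (⊨-bigAnd⁺ _ (All.map⁺ (All.map (λ lab≢p → cong not (¬-not (lab≢p ∘ ⊨-var⁻ {X} {v})))
                                    (All.all-filter _ (allFin s)))))

  ⊨-litType⇒lab≡ : ∀ {X : Graph s} {v} a → X , v ⊨ litType a → lab X v ≡ a
  ⊨-litType⇒lab≡ {X} {v} (just q) ⊨a =
    ⊨-var⁻ {X} {v} (lookup (All.map⁻ (⊨-bigAnd⁻ _ (∧-conicalˡ _ _ ⊨a)))
                           (∈-filter⁺ (λ p → ≡-dec _≟ᶠ_ (just q) (just p)) (∈-allFin q) refl))
  ⊨-litType⇒lab≡ {X} {v} nothing ⊨a = lab≡nothing (lab X v) refl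
    where
    lab≡nothing : ∀ a → lab X v ≡ a → lab X v ≡ nothing
    lab≡nothing nothing  lab≡ = lab≡
    lab≡nothing (just q) lab≡ = contradiction (sym ⊨¬q) (not-¬ (sym (⊨-var⁺ {X} {v} lab≡)))
      where
      ⊨¬q : X , v ⊨ (¬f var q)
      ⊨¬q = lookup (All.map⁻ (⊨-bigAnd⁻ _ (∧-conicalʳ _ _ ⊨a)))
                   (∈-filter⁺ (λ p → ¬? (≡-dec _≟ᶠ_ nothing (just p))) (∈-allFin q) λ ())

  ∈-allLabels : ∀ a → a ∈ allLabels s
  ∈-allLabels nothing  = here refl
  ∈-allLabels (just p) = there (∈-map⁺ just (∈-allFin p))

  guardedCount : (X : Graph s) → (Vertex X → Bool) → Formula s → ℕ
  guardedCount X g φ = countB (λ u → g u ∧ eval X φ u)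

  prefixCount : (X : Graph s) → Formula s → ℕ
  prefixCount X = guardedCount X (isPrefix X)

  suffixCount : (X : Graph s) → Vertex X → Formula s → ℕ
  suffixCount X v φ = countB (λ u → isSuffix X u ∧ (toℕ u <ᵇ toℕ v) ∧ eval X φ u)

  earlierSuffix : (X : Graph s) → Vertex X → Vertex X → Bool
  earlierSuffix X v u = isSuffix X u ∧ (toℕ u <ᵇ toℕ v)

  suffixCount≡guardedCount : ∀ (X : Graph s) v φ → suffixCount X v φ ≡ guardedCount X (earlierSuffix X v) φ
  suffixCount≡guardedCount X v φ =
    countIn-cong (λ u → sym (∧-assoc (isSuffix X u) (toℕ u <ᵇ toℕ v) (eval X φ u))) (allFin (n X))

module _ {s : ℕ} (k : ℕ) where

  eval-preFact : ∀ (X : Graph s) v τ c → eval X (preFact k (τ , c)) v ≡ isCappedCount k c (prefixCount X τ)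
  eval-preFact X v τ c = if-float (λ φ → eval X φ v) (c <ᵇ k)

  eval-sufFact : ∀ (X : Graph s) v τ c → eval X (sufFact k (τ , c)) v ≡ isCappedCount k c (suffixCount X v τ)
  eval-sufFact X v τ c = if-float (λ φ → eval X φ v) (c <ᵇ k)

  prefixProfile : (X : Graph s) → ℕ → List (Formula s × ℕ)
  prefixProfile X d = map (λ τ → τ , prefixCount X τ ⊓ k) (candidates k d)

  suffixProfile : (X : Graph s) → Vertex X → ℕ → List (Formula s × ℕ)
  suffixProfile X v d = map (λ τ → τ , suffixCount X v τ ⊓ k) (candidates k d)

  ⊨-mkType⁺ : ∀ {X : Graph s} {u a pre suf} → X , u ⊨ litType a →
    All (λ fact → X , u ⊨ preFact k fact) pre → All (λ fact → X , u ⊨ sufFact k fact) suf →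
    X , u ⊨ mkType k a pre suf
  ⊨-mkType⁺ ⊨a ⊨pre ⊨suf =
    cong₂ _∧_ ⊨a (cong₂ _∧_ (⊨-bigAnd⁺ _ (All.map⁺ ⊨pre)) (⊨-bigAnd⁺ _ (All.map⁺ ⊨suf)))

  ⊨-mkType⁻ : ∀ {X : Graph s} {u a pre suf} → X , u ⊨ mkType k a pre suf →
    X , u ⊨ litType a × All (λ fact → X , u ⊨ preFact k fact) pre × All (λ fact → X , u ⊨ sufFact k fact) suf
  ⊨-mkType⁻ {X} {u} {a} ⊨τ =
    ∧-conicalˡ _ _ ⊨τ , All.map⁻ (⊨-bigAnd⁻ _ (∧-conicalˡ _ _ ⊨facts))
                      , All.map⁻ (⊨-bigAnd⁻ _ (∧-conicalʳ _ _ ⊨facts))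
    where
    ⊨facts = ∧-conicalʳ (eval X (litType a) u) _ ⊨τ

  ⊨-typeOf-self : ∀ d (X : Graph s) v → X , v ⊨ typeOf k d X v
  ⊨-typeOf-self zero    X v = ⊨-litType-self X v
  ⊨-typeOf-self (suc d) X v = ⊨-mkType⁺ (⊨-litType-self X v)
    (All.map⁺ (universal (λ τ → trans (eval-preFact X v τ _) (isCappedCount-self k _)) (candidates k d)))
    (All.map⁺ (universal (λ τ → trans (eval-sufFact X v τ _) (isCappedCount-self k _)) (candidates k d)))

  record Agree (d : ℕ) (X : Graph s) (u : Vertex X) (Y : Graph s) (w : Vertex Y) : Set where
    field
      lab≡    : lab X u ≡ lab Y w
      prefix≡ : ∀ {τ} → τ ∈ candidates k d → prefixCount X τ ⊓ k ≡ prefixCount Y τ ⊓ k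
      suffix≡ : ∀ {τ} → τ ∈ candidates k d → suffixCount X u τ ⊓ k ≡ suffixCount Y w τ ⊓ k

  ⊨-typeOf⇒Agree : ∀ d {X Y : Graph s} {u w} → X , u ⊨ typeOf k (suc d) Y w → Agree d X u Y w
  ⊨-typeOf⇒Agree d {X} {Y} {u} {w} ⊨τ = record
    { lab≡    = ⊨-litType⇒lab≡ (lab Y w) ⊨lab
    ; prefix≡ = λ τ∈ → sym (isCappedCount⇒≡ (m⊓n≤n _ k)
                              (trans (sym (eval-preFact X u _ _)) (lookup (All.map⁻ ⊨prefix) τ∈)))
    ; suffix≡ = λ τ∈ → sym (isCappedCount⇒≡ (m⊓n≤n _ k)
                              (trans (sym (eval-sufFact X u _ _)) (lookup (All.map⁻ ⊨suffix) τ∈)))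
    }
    where
    ⊨lab×⊨prefix×⊨suffix = ⊨-mkType⁻ {a = lab Y w} {prefixProfile Y d} {suffixProfile Y w d} ⊨τ
    ⊨lab    = proj₁ ⊨lab×⊨prefix×⊨suffix
    ⊨prefix = proj₁ (proj₂ ⊨lab×⊨prefix×⊨suffix)
    ⊨suffix = proj₂ (proj₂ ⊨lab×⊨prefix×⊨suffix)

  Agree⇒typeOf≡ : ∀ {d} {X Y : Graph s} {u w} → Agree d X u Y w → typeOf k (suc d) X u ≡ typeOf k (suc d) Y w
  Agree⇒typeOf≡ agree rewrite Agree.lab≡ agree =
    cong₂ (mkType k _) (map-cong-local (tabulate (cong (_ ,_) ∘ Agree.prefix≡ agree)))
                       (map-cong-local (tabulate (cong (_ ,_) ∘ Agree.suffix≡ agree)))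

  ⊨-typeOf⇒lab≡ : ∀ d {X Y : Graph s} {u w} → X , u ⊨ typeOf k d Y w → lab X u ≡ lab Y w
  ⊨-typeOf⇒lab≡ zero    {X} {Y} {u} {w} ⊨τ = ⊨-litType⇒lab≡ {X = X} {u} (lab Y w) ⊨τ
  ⊨-typeOf⇒lab≡ (suc d) {X} {Y} {u} {w} ⊨τ = Agree.lab≡ (⊨-typeOf⇒Agree d {X} {Y} {u} {w} ⊨τ)

  ⊨-typeOf⇒typeOf≡ : ∀ d {X Y : Graph s} {u w} → X , u ⊨ typeOf k d Y w → typeOf k d X u ≡ typeOf k d Y w
  ⊨-typeOf⇒typeOf≡ zero    {X} {Y} {u} {w} ⊨τ = cong litType (⊨-typeOf⇒lab≡ zero {X} {Y} {u} {w} ⊨τ)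
  ⊨-typeOf⇒typeOf≡ (suc d) {X} {Y} {u} {w} ⊨τ = Agree⇒typeOf≡ (⊨-typeOf⇒Agree d {X} {Y} {u} {w} ⊨τ)

  typeOf≡⇒⊨ : ∀ d (X Y : Graph s) u w → typeOf k d X u ≡ typeOf k d Y w → X , u ⊨ typeOf k d Y w
  typeOf≡⇒⊨ d X Y u w τ≡ = subst (λ τ → X , u ⊨ τ) τ≡ (⊨-typeOf-self d X u)

  typeOf≡⇒Agree : ∀ d (X Y : Graph s) u w → typeOf k (suc d) X u ≡ typeOf k (suc d) Y w → Agree d X u Y w
  typeOf≡⇒Agree d X Y u w τ≡ = ⊨-typeOf⇒Agree d {X} {Y} {u} {w} (typeOf≡⇒⊨ (suc d) X Y u w τ≡)

  typeOf∈candidates : ∀ d (X : Graph s) u → typeOf k d X u ∈ candidates k d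
  typeOf∈candidates zero    X u = ∈-map⁺ litType (∈-allLabels (lab X u))
  typeOf∈candidates (suc d) X u = subst (_∈ candidates k (suc d)) zipped member
    where
    T  = candidates k d
    cs = map (λ τ → prefixCount X τ ⊓ k) T
    ds = map (λ τ → suffixCount X u τ ⊓ k) T
    typesWithLabel : Label s → List (Formula s)
    typesWithLabel a =
      concatMap (λ cs → map (λ ds → mkType k a (zip T cs) (zip T ds)) (seqs k (length T))) (seqs k (length T))
    member : mkType k (lab X u) (zip T cs) (zip T ds) ∈ candidates k (suc d)
    member = ∈-concatMap⁺ typesWithLabel (lose (∈-allLabels (lab X u))
               (∈-concatMap⁺ (λ cs → map (λ ds → mkType k (lab X u) (zip T cs) (zip T ds)) (seqs k (length T)))
                 (lose (cappedCounts∈seqs k (prefixCount X) T)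
                   (∈-map⁺ (λ ds → mkType k (lab X u) (zip T cs) (zip T ds))
                           (cappedCounts∈seqs k (suffixCount X u) T)))))
    zipped : mkType k (lab X u) (zip T cs) (zip T ds) ≡ typeOf k (suc d) X u
    zipped = cong₂ (mkType k (lab X u)) (zip-map-graph (λ τ → prefixCount X τ ⊓ k) T)
                                        (zip-map-graph (λ τ → suffixCount X u τ ⊓ k) T)

  TypeInvariant : ℕ → Formula s → Set
  TypeInvariant d ψ = ∀ (X Y : Graph s) u w → typeOf k d X u ≡ typeOf k d Y w → eval X ψ u ≡ eval Y ψ w

  TypeInvariant⇒guardedCount-⊓ : ∀ d ψ → TypeInvariant d ψ →
    ∀ {G H : Graph s} (g₁ : Vertex G → Bool) (g₂ : Vertex H → Bool) →
    (∀ {τ} → τ ∈ candidates k d → guardedCount G g₁ τ ⊓ k ≡ guardedCount H g₂ τ ⊓ k) →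
    guardedCount G g₁ ψ ⊓ k ≡ guardedCount H g₂ ψ ⊓ k
  TypeInvariant⇒guardedCount-⊓ d ψ invariant {G} {H} g₁ g₂ candidateCounts =
    countB-⊓-partition k types (partition G g₁ (∈-++⁺ˡ ∘ ∈-map⁺ (G ,_) ∘ ∈-allFin))
                               (partition H g₂ (∈-++⁺ʳ _ ∘ ∈-map⁺ (H ,_) ∘ ∈-allFin)) classCount
    where
    -- Only types realised in G or H serve as classes: for these, satisfying a type means having it.
    representatives : List (Σ (Graph s) Vertex)
    representatives = map (G ,_) (allFin (n G)) ++ map (H ,_) (allFin (n H))

    types : List (Formula s)
    types = map (uncurry (typeOf k d)) representatives

    ⊨-types⇒typeOf≡ : ∀ {X : Graph s} {u τ} → τ ∈ types → X , u ⊨ τ → typeOf k d X u ≡ τ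
    ⊨-types⇒typeOf≡ τ∈ ⊨τ with ∈-map⁻ (uncurry (typeOf k d)) τ∈
    ... | (Y , w) , _ , refl = ⊨-typeOf⇒typeOf≡ d ⊨τ

    partition : ∀ (X : Graph s) g → (∀ u → (X , u) ∈ representatives) →
      Partitions (eval X) types (λ u → g u ∧ eval X ψ u)
    partition X g rep∈ = record
      { covers    = λ u _ → lose (∈-map⁺ (uncurry (typeOf k d)) (rep∈ u)) (⊨-typeOf-self d X u)
      ; exclusive = λ τ∈ τ′∈ ⊨τ ⊨τ′ → trans (sym (⊨-types⇒typeOf≡ τ∈ ⊨τ)) (⊨-types⇒typeOf≡ τ′∈ ⊨τ′)
      }

    classCount : ∀ {τ} → τ ∈ types →
      countB (λ u → (g₁ u ∧ eval G ψ u) ∧ eval G τ u) ⊓ k ≡ countB (λ u → (g₂ u ∧ eval H ψ u) ∧ eval H τ u) ⊓ k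
    classCount τ∈ with ∈-map⁻ (uncurry (typeOf k d)) τ∈
    ... | (Y , w) , _ , refl = begin
      countB (λ u → (g₁ u ∧ eval G ψ u) ∧ eval G τ u) ⊓ k
        ≡⟨ cong (_⊓ k) (restrict G g₁) ⟩
      countB (λ u → (g₁ u ∧ eval G τ u) ∧ b) ⊓ k
        ≡⟨ countB-∧-cong-⊓ {f₁ = λ u → g₁ u ∧ eval G τ u} {λ u → g₂ u ∧ eval H τ u} k b
                           (candidateCounts (typeOf∈candidates d Y w)) ⟩
      countB (λ u → (g₂ u ∧ eval H τ u) ∧ b) ⊓ k
        ≡⟨ cong (_⊓ k) (restrict H g₂) ⟨
      countB (λ u → (g₂ u ∧ eval H ψ u) ∧ eval H τ u) ⊓ k ∎
      where
      τ = typeOf k d Y w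
      b = eval Y ψ w
      restrict : ∀ (X : Graph s) g →
        countB (λ u → (g u ∧ eval X ψ u) ∧ eval X τ u) ≡ countB (λ u → (g u ∧ eval X τ u) ∧ b)
      restrict X g = countIn-cong (λ u → ∧-∧-restrict (g u) (eval X τ u)
                                          (λ ⊨τ → invariant X Y u w (⊨-typeOf⇒typeOf≡ d ⊨τ)))
                                  (allFin (n X))

  prefixCount-⊓ : ∀ d ψ → TypeInvariant d ψ → ∀ {X Y : Graph s} {u w} → Agree d X u Y w →
    prefixCount X ψ ⊓ k ≡ prefixCount Y ψ ⊓ k
  prefixCount-⊓ d ψ invariant {X} {Y} agree =
    TypeInvariant⇒guardedCount-⊓ d ψ invariant (isPrefix X) (isPrefix Y) (Agree.prefix≡ agree)

  suffixCount-⊓ : ∀ d ψ → TypeInvariant d ψ → ∀ {X Y : Graph s} {u w} → Agree d X u Y w →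
    suffixCount X u ψ ⊓ k ≡ suffixCount Y w ψ ⊓ k
  suffixCount-⊓ d ψ invariant {X} {Y} {u} {w} agree = begin
    suffixCount X u ψ ⊓ k
      ≡⟨ cong (_⊓ k) (suffixCount≡guardedCount X u ψ) ⟩
    guardedCount X (earlierSuffix X u) ψ ⊓ k
      ≡⟨ TypeInvariant⇒guardedCount-⊓ d ψ invariant (earlierSuffix X u) (earlierSuffix Y w) candidateCounts ⟩
    guardedCount Y (earlierSuffix Y w) ψ ⊓ k
      ≡⟨ cong (_⊓ k) (suffixCount≡guardedCount Y w ψ) ⟨
    suffixCount Y w ψ ⊓ k ∎
    where
    candidateCounts : ∀ {τ} → τ ∈ candidates k d →
      guardedCount X (earlierSuffix X u) τ ⊓ k ≡ guardedCount Y (earlierSuffix Y w) τ ⊓ k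
    candidateCounts {τ} τ∈ = begin
      guardedCount X (earlierSuffix X u) τ ⊓ k  ≡⟨ cong (_⊓ k) (suffixCount≡guardedCount X u τ) ⟨
      suffixCount X u τ ⊓ k                     ≡⟨ Agree.suffix≡ agree τ∈ ⟩
      suffixCount Y w τ ⊓ k                     ≡⟨ cong (_⊓ k) (suffixCount≡guardedCount Y w τ) ⟩
      guardedCount Y (earlierSuffix Y w) τ ⊓ k  ∎

  typeInvariant : ∀ d φ → md φ ≤ d → width φ ≤ k → TypeInvariant d φ
  typeInvariant d ⊥f _ _ X Y u w τ≡ = refl
  typeInvariant d (var p) _ _ X Y u w τ≡ =
    eval-var-cong {X = X} {Y} {u} {w} p (⊨-typeOf⇒lab≡ d (typeOf≡⇒⊨ d X Y u w τ≡))
  typeInvariant d (¬f φ) md≤ width≤ X Y u w τ≡ = cong not (typeInvariant d φ md≤ width≤ X Y u w τ≡)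
  typeInvariant d (φ ∧f ψ) md≤ width≤ X Y u w τ≡ = cong₂ _∧_
    (typeInvariant d φ (m⊔n≤o⇒m≤o _ _ md≤) (m⊔n≤o⇒m≤o _ _ width≤) X Y u w τ≡)
    (typeInvariant d ψ (m⊔n≤o⇒n≤o _ _ md≤) (m⊔n≤o⇒n≤o _ _ width≤) X Y u w τ≡)
  typeInvariant (suc d) (⟨G⟩pre≥ m ψ) (s≤s md≤) width≤ X Y u w τ≡ =
    ≤ᵇ-cong-⊓ {m} (m⊔n≤o⇒n≤o _ _ width≤)
      (prefixCount-⊓ d ψ (typeInvariant d ψ md≤ (m⊔n≤o⇒m≤o _ _ width≤))
                         (typeOf≡⇒Agree d X Y u w τ≡))
  typeInvariant (suc d) (⟨P⟩suf≥ m ψ) (s≤s md≤) width≤ X Y u w τ≡ =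
    ≤ᵇ-cong-⊓ {m} (m⊔n≤o⇒n≤o _ _ width≤)
      (suffixCount-⊓ d ψ (typeInvariant d ψ md≤ (m⊔n≤o⇒m≤o _ _ width≤))
                         (typeOf≡⇒Agree d X Y u w τ≡))

lemma1 : ∀ {s : ℕ} (k d : ℕ) (G H : Graph s) (i : Vertex G) (j : Vertex H)
           → typeOf k d G i ≡ typeOf k d H j
           → ¬ (Σ[ φ ∈ Formula s ] (md φ ≤ d × width φ ≤ k × (G , i ⊨ φ) × ¬ (H , j ⊨ φ)))
lemma1 k d G H i j τ≡ (φ , md≤ , width≤ , G⊨φ , H⊭φ) =
  H⊭φ (trans (sym (typeInvariant k d φ md≤ width≤ G H i j τ≡)) G⊨φ)
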